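{- Let $\langle\mathbf{A}_{\mathrm d},\mathbf{A},\iota\rangle$ be a distributively generated (generalized) additive quantale with multiplication, let $\mathbf{Q}$ be an $\mathbf{A}$-module, and let $\theta$ be a congruence on the (generalized) quantale $\mathbf{Q}$ which is structural with respect to each $a\in\iota[\mathbf{A}_{\mathrm d}]$. Then $\theta$ is structural (with respect to every $a\in\mathbf{A}$).
   Context: Fix one of two parallel settings: plain ("joins" = joins of arbitrary families) or generalized ("joins" = joins of non-empty families). A (generalized) quantale is $\langle Q,\bigvee,+,\mathsf{0}\rangle$ with $Q$ a poset having all such joins, $\langle Q,+,\mathsf{0}\rangle$ a monoid with $+$ order-preserving and distributing over such joins on both sides. A (generalized) additive quantale with multiplication is a triple $\langle\mathbf{A}_{\mathrm d},\mathbf{A},\iota\rangle$: $\mathbf{A}_{\mathrm d}$ a monoid, $\mathbf{A}$ a (generalized) quantale with an additional monoid structure $\langle A,\cdot,\mathsf 1\rangle$, $\iota\colon\mathbf{A}_{\mathrm d}\to\mathbf{A}$ a monoid homomorphism, such that $(\bigvee_i a_i)\cdot b=\bigvee_i(a_i\cdot b)$, $(a+b)\cdot c=a\cdot c+b\cdot c$, $\mathsf0\cdot a=\mathsf0$, and for $d\in\mathbf{A}_{\mathrm d}$ left multiplication by $\iota(d)$ preserves joins, $+$ and $\mathsf0$. It is distributively generated if $\mathbf{A}$ is generated as a (generalized) quantale by $\iota[\mathbf{A}_{\mathrm d}]$. An $\mathbf{A}$-module is a (generalized) quantale $\mathbf{Q}$ with a map $\ast\colon A\times Q\to Q$, order-preserving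 in both coordinates, with $(a\cdot b)\ast x=a\ast(b\ast x)$, $\mathsf1\ast x=x$, $(a+b)\ast x=a\ast x+b\ast x$, $\mathsf0\ast x=\mathsf0$, $(\bigvee_i a_i)\ast x=\bigvee_i(a_i\ast x)$, and for $d\in\mathbf{A}_{\mathrm d}$ the map $x\mapsto\iota(d)\ast x$ preserves $+$, $\mathsf0$ and joins. A congruence on $\mathbf{Q}$ is an equivalence relation compatible with $+$ and with (non-empty) joins. A congruence $\theta$ is structural with respect to $a\in A$ if $\langle x,y\rangle\in\theta$ implies $\langle a\ast x,a\ast y\rangle\in\theta$. -}

module Defs where

open import Level using (Level; _⊔_; suc; Lift)
open import Data.Bool using (Bool; true; false)
open import Data.Unit using (⊤)
open import Relation.Binary.PropositionalEquality using (_≡_)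
open import Relation.Binary.Core using (Rel)
open import Relation.Binary.Structures using (IsPartialOrder; IsEquivalence)
open import Algebra.Structures using (IsMonoid)

-- The two parallel settings:
--   false = plain setting       (joins of arbitrary families)
--   true  = generalized setting (joins of non-empty families)
-- A family indexed by I is admissible if (generalized) I is inhabited.
Admissible : ∀ {ι} → Bool → Set ι → Set ι
Admissible false I = Lift _ ⊤
Admissible true  I = I

record Quantale (g : Bool) (c ℓ ι : Level) : Set (suc (c ⊔ ℓ ⊔ ι)) where
  infixl 6 _+_
  infix 4 _≤_
  field
    Carrier        : Set c
    _≤_            : Rel Carrier ℓ
    isPartialOrder : IsPartialOrder _≡_ _≤_
    ⋁              : {I : Set ι} → Admissible g I → (I → Carrier) → Carrier
    ⋁-upper        : ∀ {I : Set ι} (ne : Admissible g I) (f : I → Carrier) (i : I) → f i ≤ ⋁ ne f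
    ⋁-least        : ∀ {I : Set ι} (ne : Admissible g I) (f : I → Carrier) (x : Carrier) →
                     (∀ i → f i ≤ x) → ⋁ ne f ≤ x
    _+_            : Carrier → Carrier → Carrier
    0#             : Carrier
    +-isMonoid     : IsMonoid _≡_ _+_ 0#
    +-mono         : ∀ {x x′ y y′} → x ≤ x′ → y ≤ y′ → x + y ≤ x′ + y′
    +-distribˡ-⋁   : ∀ {I : Set ι} (ne : Admissible g I) (f : I → Carrier) (x : Carrier) →
                     x + ⋁ ne f ≡ ⋁ ne (λ i → x + f i)
    +-distribʳ-⋁   : ∀ {I : Set ι} (ne : Admissible g I) (f : I → Carrier) (x : Carrier) →
                     ⋁ ne f + x ≡ ⋁ ne (λ i → f i + x)

record AddQuantaleMult (g : Bool) (cd c ℓ ι : Level) : Set (suc (cd ⊔ c ⊔ ℓ ⊔ ι)) where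
  field
    D            : Set cd
    _∙_          : D → D → D
    ε            : D
    D-isMonoid   : IsMonoid _≡_ _∙_ ε
    A            : Quantale g c ℓ ι
  open Quantale A
  infixl 7 _·_
  field
    _·_          : Carrier → Carrier → Carrier
    1#           : Carrier
    ·-isMonoid   : IsMonoid _≡_ _·_ 1#
    emb          : D → Carrier                -- the map ι
    emb-∙        : ∀ d e → emb (d ∙ e) ≡ emb d · emb e
    emb-ε        : emb ε ≡ 1#
    ·-distribʳ-⋁ : ∀ {I : Set ι} (ne : Admissible g I) (f : I → Carrier) (b : Carrier) →
                   ⋁ ne f · b ≡ ⋁ ne (λ i → f i · b)
    ·-distribʳ-+ : ∀ a b c → (a + b) · c ≡ a · c + b · c
    ·-zeroˡ      : ∀ a → 0# · a ≡ 0#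
    emb-⋁        : ∀ (d : D) {I : Set ι} (ne : Admissible g I) (f : I → Carrier) →
                   emb d · ⋁ ne f ≡ ⋁ ne (λ i → emb d · f i)
    emb-+        : ∀ (d : D) a b → emb d · (a + b) ≡ emb d · a + emb d · b
    emb-0        : ∀ (d : D) → emb d · 0# ≡ 0#

module _ {g : Bool} {cd c ℓ ι : Level} (M : AddQuantaleMult g cd c ℓ ι) where
  open AddQuantaleMult M
  open Quantale A

  data Generated : Carrier → Set (c ⊔ cd ⊔ suc ι) where
    gen  : ∀ d → Generated (emb d)
    join : ∀ {I : Set ι} (ne : Admissible g I) (f : I → Carrier) →
           (∀ i → Generated (f i)) → Generated (⋁ ne f)
    plus : ∀ {a b} → Generated a → Generated b → Generated (a + b)
    zero : Generated 0#

  DistributivelyGenerated : Set (c ⊔ cd ⊔ suc ι)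
  DistributivelyGenerated = ∀ a → Generated a

  record Module (cq ℓq : Level) : Set (suc (cd ⊔ c ⊔ ℓ ⊔ ι ⊔ cq ⊔ ℓq)) where
    field
      Q : Quantale g cq ℓq ι
    module Q = Quantale Q
    infixr 7 _*_
    field
      _*_      : Carrier → Q.Carrier → Q.Carrier
      *-mono   : ∀ {a a′ x x′} → a ≤ a′ → x Q.≤ x′ → a * x Q.≤ a′ * x′
      *-assoc  : ∀ a b x → (a · b) * x ≡ a * (b * x)
      *-identity : ∀ x → 1# * x ≡ x
      *-+ˡ     : ∀ a b x → (a + b) * x ≡ a * x Q.+ b * x
      *-0ˡ     : ∀ x → 0# * x ≡ Q.0#
      *-⋁ˡ     : ∀ {I : Set ι} (ne : Admissible g I) (f : I → Carrier) (x : Q.Carrier) →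
                 ⋁ ne f * x ≡ Q.⋁ ne (λ i → f i * x)
      emb-*-+  : ∀ (d : D) x y → emb d * (x Q.+ y) ≡ emb d * x Q.+ emb d * y
      emb-*-0  : ∀ (d : D) → emb d * Q.0# ≡ Q.0#
      emb-*-⋁  : ∀ (d : D) {I : Set ι} (ne : Admissible g I) (f : I → Q.Carrier) →
                 emb d * Q.⋁ ne f ≡ Q.⋁ ne (λ i → emb d * f i)

record IsCongruence {g : Bool} {c ℓ ι r : Level} (Q : Quantale g c ℓ ι)
                    (θ : Rel (Quantale.Carrier Q) r) : Set (c ⊔ suc ι ⊔ r) where
  open Quantale Q
  field
    isEquivalence : IsEquivalence θ
    +-cong        : ∀ {x x′ y y′} → θ x x′ → θ y y′ → θ (x + y) (x′ + y′)
    ⋁-cong        : ∀ {I : Set ι} (ne : Admissible g I) (f h : I → Carrier) →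
                    (∀ i → θ (f i) (h i)) → θ (⋁ ne f) (⋁ ne h)

Structural : ∀ {g cd c ℓ ι cq ℓq r} {M : AddQuantaleMult g cd c ℓ ι} (Mod : Module M cq ℓq) →
             Rel (Quantale.Carrier (Module.Q Mod)) r →
             Quantale.Carrier (AddQuantaleMult.A M) → Set (cq ⊔ r)
Structural Mod θ a = ∀ x y → θ x y → θ (a * x) (a * y)
  where open Module Mod

module Submission where

open import Defs
open import Level using (Level)
open import Data.Bool using (Bool)
open import Relation.Binary.Core using (Rel)
open import Relation.Binary.Structures using (IsEquivalence)
open import Relation.Binary.PropositionalEquality using (subst₂; sym)

-- The elements a for which θ is structural form a sub-(generalized-)quantale of A,
-- because a ↦ a * x preserves joins, + and 0 in its first argument and θ is a
-- congruence. It therefore contains everything generated by ι[A_d].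

module _ {g : Bool} {cd c ℓ ι cq ℓq r : Level}
         {M : AddQuantaleMult g cd c ℓ ι} (Mod : Module M cq ℓq)
         {θ : Rel (Quantale.Carrier (Module.Q Mod)) r}
         (θ-cong : IsCongruence (Module.Q Mod) θ) where

  open AddQuantaleMult M
  open Quantale A
  open Module Mod
  open IsCongruence θ-cong

  structural-0# : Structural Mod θ 0#
  structural-0# x y _ =
    subst₂ θ (sym (*-0ˡ x)) (sym (*-0ˡ y)) (IsEquivalence.refl isEquivalence)

  structural-+ : ∀ {a b} → Structural Mod θ a → Structural Mod θ b → Structural Mod θ (a + b)
  structural-+ {a} {b} sa sb x y xθy =
    subst₂ θ (sym (*-+ˡ a b x)) (sym (*-+ˡ a b y)) (+-cong (sa x y xθy) (sb x y xθy))

  structural-⋁ : ∀ {I : Set ι} (ne : Admissible g I) (f : I → Carrier) →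
                 (∀ i → Structural Mod θ (f i)) → Structural Mod θ (⋁ ne f)
  structural-⋁ ne f sf x y xθy =
    subst₂ θ (sym (*-⋁ˡ ne f x)) (sym (*-⋁ˡ ne f y))
      (⋁-cong ne (λ i → f i * x) (λ i → f i * y) (λ i → sf i x y xθy))

  generated⇒structural : (∀ d → Structural Mod θ (emb d)) →
                         ∀ {a} → Generated M a → Structural Mod θ a
  generated⇒structural s-emb (gen d)         = s-emb d
  generated⇒structural s-emb (join ne f gf)  =
    structural-⋁ ne f (λ i → generated⇒structural s-emb (gf i))
  generated⇒structural s-emb (plus ga gb)    =
    structural-+ (generated⇒structural s-emb ga) (generated⇒structural s-emb gb)
  generated⇒structural s-emb zero            = structural-0#

lemma5p6 : ∀ {g : Bool} {cd c ℓ ι cq ℓq r : Level}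
    (M : AddQuantaleMult g cd c ℓ ι) → DistributivelyGenerated M →
    (Mod : Module M cq ℓq) →
    (θ : Rel (Quantale.Carrier (Module.Q Mod)) r) → IsCongruence (Module.Q Mod) θ →
    (∀ d → Structural Mod θ (AddQuantaleMult.emb M d)) →
    ∀ a → Structural Mod θ a
lemma5p6 M dg Mod θ θ-cong s-emb a = generated⇒structural Mod θ-cong s-emb (dg a)
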